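{- Let a GCR game family be given, let $\overline{T}(s)=\lim_{i\to\infty}T^i(s)$ for $s\in\overline{S}$ be the limits of the vertex labeling algorithm, and define positional strategies $\widehat{\sigma}^1$ (Pursuer) and $\widehat{\sigma}^2$ (Evader) by $\widehat{\sigma}^1(s)=\arg\min_{s'\in N(s)}\overline{T}(s')$ for $s\in S^1\setminus S_c$ and $\widehat{\sigma}^2(s)=\arg\max_{s'\in N(s)}\overline{T}(s')$ for $s\in S^2\setminus S_c$, where $\arg\min$ (resp. $\arg\max$) denotes the first element of $N(s)$, with respect to a fixed total order on $\overline{S}$, attaining the minimum (resp. maximum). Then for every $s\in\overline{S}$, $\overline{T}(s)$ is the value of the game started at $s$, and $\widehat{\sigma}^1,\widehat{\sigma}^2$ are optimal positional strategies; that is, for all $s\in\overline{S}$, all Pursuer strategies $\sigma^1$ and all Evader strategies $\sigma^2$, $T(\widehat{\sigma}^1,\sigma^2\mid s)\le\overline{T}(s)\le T(\sigma^1,\widehat{\sigma}^2\mid s)$.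
   Context: A GCR game family consists of: finite location sets $V^1,V^2$; nonterminal states $\overline{S}=V^1\times V^2\times\{1,2\}$, where in state $(x^1,x^2,n)$ player $P^n$ has the move ($P^1$ Pursuer, $P^2$ Evader); $S^n=\{(x^1,x^2,n)\}$; a set of capture states $S_c\subseteq\overline{S}$, $S_{nc}=\overline{S}\setminus S_c$; a terminal state $\tau$, $S=\overline{S}\cup\{\tau\}$; for each $s\in S_{nc}$ a nonempty set $N(s)\subseteq\overline{S}$ of possible next states, while $N(s)=\{\tau\}$ for $s\in S_c$ and $N(\tau)=\{\tau\}$. Players need not alternate. A (pure) strategy for $P^n$ is a map $\sigma^n$ from finite sequences of states $s_0\dots s_t$ to states with $\sigma^n(s_0\dots s_t)\in N(s_t)$ whenever $s_t\in S^n\setminus S_c$; it is positional if its value depends only on the last state $s_t$. Given strategies $\sigma^1,\sigma^2$ and $s_0\in\overline{S}$, the play $s_0s_1s_2\dots$ is defined by $s_{t+1}=\sigma^n(s_0\dots s_t)$ if $s_t\in S^n\setminus S_c$ and $s_{t+1}=\tau$ if $s_t\in S_c\cup\{\tau\}$. The capture time is $T(\sigma^1,\sigma^2\mid s_0)=\sum_{t\ge0}q(s_t)$ where $q(s)=1$ if $s\in S_{nc}$ and $q(s)=0$ otherwise; equivalently, it is the first $t$ with $s_t\in S_c$, or $\infty$ if there is none. The Pursuer minimizes and the Evader maximizes $T$. The game from $s$ has value $\widehat{T}(s)$ if $\sup_{\sigma^2}\inf_{\sigma^1}T(\sigma^1,\sigma^2\mid s)=\inf_{\sigma^1}\sup_{\sigma^2}T(\sigma^1,\sigma^2\mid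 s)=\widehat{T}(s)$; strategies $\widehat\sigma^1,\widehat\sigma^2$ are optimal if $T(\widehat{\sigma}^1,\sigma^2\mid s)\le\widehat T(s)\le T(\sigma^1,\widehat{\sigma}^2\mid s)$ for all $\sigma^1,\sigma^2$ (this is equivalent to the game having value $\widehat T(s)$ attained by optimal strategies). Vertex labeling algorithm: $T^0(s)=0$ if $s\in S_c$, $T^0(s)=\infty$ otherwise; for $i\ge1$ and $s\in\overline{S}$: if $T^{i-1}(s)<\infty$ then $T^i(s)=T^{i-1}(s)$; else if $s\in S^1$ then $T^i(s)=1+\min_{s'\in N(s)}T^{i-1}(s')$, and if $s\in S^2$ then $T^i(s)=1+\max_{s'\in N(s)}T^{i-1}(s')$ (with $1+\infty=\infty$). Each sequence $(T^i(s))_i$ is eventually constant. -}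

module Defs where

open import Data.Nat using (ℕ; zero; suc; _≤_; _<_; _≟_)
open import Data.Bool using (Bool; true; false; if_then_else_)
open import Data.Fin using (Fin)
open import Data.List using (List; []; _∷_; _++_; [_]; foldr; concatMap; map)
open import Data.Fin.Base using () renaming (zero to fzero)
open import Data.List.Base using () 
open import Data.Maybe using (Maybe; just; nothing)
open import Data.Product using (_×_; _,_; proj₁; proj₂; ∃-syntax)
open import Data.Empty using (⊥)
open import Data.Unit using (⊤)
open import Relation.Binary.PropositionalEquality using (_≡_)
open import Relation.Nullary using (¬_; yes; no)
open import Data.List using (allFin)

data ℕ∞ : Set where
  fin : ℕ → ℕ∞
  ∞   : ℕ∞

suc∞ : ℕ∞ → ℕ∞
suc∞ (fin k) = fin (suc k)
suc∞ ∞       = ∞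

min∞ : ℕ∞ → ℕ∞ → ℕ∞
min∞ (fin a) (fin b) = fin (Data.Nat._⊓_ a b)
min∞ (fin a) ∞       = fin a
min∞ ∞       y       = y

max∞ : ℕ∞ → ℕ∞ → ℕ∞
max∞ (fin a) (fin b) = fin (Data.Nat._⊔_ a b)
max∞ (fin a) ∞       = ∞
max∞ ∞       y       = ∞

_==∞_ : ℕ∞ → ℕ∞ → Bool
fin a ==∞ fin b with a ≟ b
... | yes _ = true
... | no  _ = false
fin a ==∞ ∞     = false
∞     ==∞ fin b = false
∞     ==∞ ∞     = true

data Player : Set where
  P1 P2 : Player   -- P1 = Pursuer, P2 = Evader

allPlayers : List Player
allPlayers = P1 ∷ P2 ∷ []

-- V¹ = Fin n₁, V² = Fin n₂; nonterminal states S̄ = V¹ × V² × {P1,P2}.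
-- The terminal state τ is not an element of State; it is modelled
-- separately in plays (see Pos below).

record GCR : Set where
  field
    n₁ n₂ : ℕ
  State : Set
  State = Fin n₁ × Fin n₂ × Player
  field
    capture : State → Bool
    -- N s s' ≡ true  iff  s' ∈ N(s)   (only relevant for s ∈ S_nc;
    -- for s ∈ S_c the game moves to τ regardless)
    N : State → State → Bool
    N-nonempty : ∀ s → capture s ≡ false → ∃[ s' ] N s s' ≡ true

module _ (G : GCR) where
  open GCR G

  owner : State → Player
  owner s = proj₂ (proj₂ s)

  allStates : List State
  allStates = concatMap (λ x → concatMap (λ y → map (λ p → x , y , p) allPlayers)
                                         (allFin n₂)) (allFin n₁)

  minOver : (State → ℕ∞) → State → ℕ∞
  minOver f s = foldr (λ s' acc → if N s s' then min∞ (f s') acc else acc) ∞ allStates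

  maxOver : (State → ℕ∞) → State → ℕ∞
  maxOver f s = foldr (λ s' acc → if N s s' then max∞ (f s') acc else acc) (fin 0) allStates

  VL : ℕ → State → ℕ∞
  VL zero s = if capture s then fin 0 else ∞
  VL (suc i) s with VL i s
  ... | fin k = fin k
  ... | ∞ with owner s
  ...   | P1 = suc∞ (minOver (VL i) s)
  ...   | P2 = suc∞ (maxOver (VL i) s)

  -- A strategy maps a history s₀ … s_{t-1} (given as a list,
  -- chronological) together with the current state s_t to the next state.
  -- While the play has not reached τ all states in the history lie in S̄.

  Strategy : Set
  Strategy = List State → State → State

  Legal : Player → Strategy → Set
  Legal n σ = ∀ h s → owner s ≡ n → capture s ≡ false → N s (σ h s) ≡ true

  Positional : Strategy → Set
  Positional σ = ∀ h h' s → σ h s ≡ σ h' s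

  -- Plays.  Pos t is either  alive h s  (s_t = s ∈ S̄, with history h)
  -- or  dead  (s_t = τ).

  data Pos : Set where
    alive : List State → State → Pos
    dead  : Pos

  mover : Strategy → Strategy → Player → Strategy
  mover σ¹ σ² P1 = σ¹
  mover σ¹ σ² P2 = σ²

  step : Strategy → Strategy → Pos → Pos
  step σ¹ σ² dead = dead
  step σ¹ σ² (alive h s) =
    if capture s then dead
    else alive (h ++ [ s ]) (mover σ¹ σ² (owner s) h s)

  play : Strategy → Strategy → State → ℕ → Pos
  play σ¹ σ² s₀ zero    = alive [] s₀
  play σ¹ σ² s₀ (suc t) = step σ¹ σ² (play σ¹ σ² s₀ t)

  CapturedAt : Pos → Set
  CapturedAt dead        = ⊥
  CapturedAt (alive _ s) = capture s ≡ true

  -- Capture time T(σ¹,σ²|s₀) = first t with s_t ∈ S_c (∞ if none).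
  -- Comparisons with an element x of ℕ∞, written out:
  --   T ≤ x :
  CapTime≤ : (ℕ → Pos) → ℕ∞ → Set
  CapTime≤ p (fin k) = ∃[ t ] (t ≤ k × CapturedAt (p t))
  CapTime≤ p ∞       = ⊤
  --   x ≤ T :
  ≤CapTime : (ℕ → Pos) → ℕ∞ → Set
  ≤CapTime p (fin k) = ∀ t → t < k → ¬ CapturedAt (p t)
  ≤CapTime p ∞       = ∀ t → ¬ CapturedAt (p t)

  -- argmin / argmax strategies w.r.t. a total order on S̄ given as a
  -- list `ord` (first element = smallest).

  firstWhere : (State → Bool) → List State → Maybe State
  firstWhere P []       = nothing
  firstWhere P (x ∷ xs) = if P x then just x else firstWhere P xs

  -- default (never used for s ∈ S_nc, since N(s) ≠ ∅): s itself
  fromMaybe : State → Maybe State → State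
  fromMaybe d (just x) = x
  fromMaybe d nothing  = d

  argmin : List State → (State → ℕ∞) → State → State
  argmin ord f s = fromMaybe s (firstWhere (λ s' → if N s s' then f s' ==∞ minOver f s else false) ord)

  argmax : List State → (State → ℕ∞) → State → State
  argmax ord f s = fromMaybe s (firstWhere (λ s' → if N s s' then f s' ==∞ maxOver f s else false) ord)

  σ̂¹ : List State → (State → ℕ∞) → Strategy
  σ̂¹ ord Tbar h s = argmin ord Tbar s

  σ̂² : List State → (State → ℕ∞) → Strategy
  σ̂² ord Tbar h s = argmax ord Tbar s

module Submission where

open import Defs
open import Data.Nat using (ℕ; _≤_)
open import Data.Product using (_×_; ∃-syntax)
open import Data.List using (List)
open import Data.List.Membership.Propositional using (_∈_)
open import Data.List.Relation.Unary.Unique.Propositional using (Unique)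
open import Relation.Binary.PropositionalEquality using (_≡_)

open import Data.Nat using (zero; suc; _<_; _⊔_; z≤n; s≤s; _≤?_; _≟_)
open import Data.Nat.Properties
  using (≤-refl; ≤-trans; ≤-antisym; ≤-total; ≰⇒>; <⇒≤; <⇒≱; n≤1+n; m≤m⊔n; m≤n⊔m; m≤n⇒m<n∨m≡n;
         m≤n⇒m⊓n≡m; m≥n⇒m⊓n≡n; m≤n⇒m⊔n≡n; m≥n⇒m⊔n≡m)
open import Data.Bool using (Bool; true; false; if_then_else_)
open import Data.List using ([]; _∷_; _++_; [_]; foldr)
open import Data.List.Relation.Unary.Any using (here; there)
open import Data.List.Membership.Propositional using (lose)
open import Data.List.Membership.Propositional.Properties using (∈-concatMap⁺; ∈-map⁺; ∈-allFin)
open import Data.Maybe using (just)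
open import Data.Product using (_,_; proj₁; proj₂)
open import Data.Sum using (_⊎_; inj₁; inj₂)
open import Data.Unit using (tt)
open import Function using (_∘_)
open import Relation.Binary.PropositionalEquality using (refl; sym; trans; cong; cong₂; subst; module ≡-Reasoning)
open import Relation.Nullary using (¬_; yes; no; contradiction)

-- Let trunc i x be the label x ∈ ℕ∞ as seen at stage i: x itself
-- if x ≤ i, and ∞ otherwise.  The key invariant of the vertex labelling is
-- that each stage is the truncation of every later one, VL j ≡ trunc j ∘ VL J
-- for j ≤ J (a state labelled k is labelled exactly from stage k on); hence
-- VL i ≡ trunc i ∘ T̄.  Truncation commutes with min, max and 1 + _, so the
-- recursion defining VL becomes the Bellman equations for T̄: T̄ s = 0 on
-- captured states, T̄ s = 1 + opt_{s' ∈ N(s)} T̄ s' elsewhere (opt = min for the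
-- Pursuer, max for the Evader).  For ANY solution W of these equations the
-- argmin/argmax strategies are legal, and along a play W drops by at least
-- one per move under σ̂¹ and by at most one per move under σ̂²; this yields
-- the two capture-time bounds.

data _≤∞_ : ℕ∞ → ℕ∞ → Set where
  fin≤fin : ∀ {m n} → m ≤ n → fin m ≤∞ fin n
  ≤∞-top  : ∀ {x} → x ≤∞ ∞

fin≢∞ : ∀ {k} → ¬ (fin k ≡ ∞)
fin≢∞ ()

≤∞-refl : ∀ {x} → x ≤∞ x
≤∞-refl {fin k} = fin≤fin ≤-refl
≤∞-refl {∞}     = ≤∞-top

≤∞-reflexive : ∀ {x y} → x ≡ y → x ≤∞ y
≤∞-reflexive refl = ≤∞-refl

≤∞-trans : ∀ {x y z} → x ≤∞ y → y ≤∞ z → x ≤∞ z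
≤∞-trans (fin≤fin p) (fin≤fin q) = fin≤fin (≤-trans p q)
≤∞-trans _           ≤∞-top      = ≤∞-top

≤∞-antisym : ∀ {x y} → x ≤∞ y → y ≤∞ x → x ≡ y
≤∞-antisym (fin≤fin p) (fin≤fin q) = cong fin (≤-antisym p q)
≤∞-antisym ≤∞-top      ≤∞-top      = refl

≤∞-total : ∀ x y → x ≤∞ y ⊎ y ≤∞ x
≤∞-total (fin m) (fin n) with ≤-total m n
... | inj₁ m≤n = inj₁ (fin≤fin m≤n)
... | inj₂ n≤m = inj₂ (fin≤fin n≤m)
≤∞-total x       ∞       = inj₁ ≤∞-top
≤∞-total ∞       (fin n) = inj₂ ≤∞-top

0≤∞ : ∀ x → fin 0 ≤∞ x
0≤∞ (fin k) = fin≤fin z≤n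
0≤∞ ∞       = ≤∞-top

suc∞≤fin : ∀ {x m} → suc∞ x ≤∞ fin m → ∃[ m' ] (m ≡ suc m' × x ≤∞ fin m')
suc∞≤fin {fin k} (fin≤fin (s≤s k≤m')) = _ , refl , fin≤fin k≤m'

fin≤suc∞ : ∀ {k x} → fin (suc k) ≤∞ suc∞ x → fin k ≤∞ x
fin≤suc∞ {x = fin n} (fin≤fin (s≤s k≤n)) = fin≤fin k≤n
fin≤suc∞ {x = ∞}     _                   = ≤∞-top

suc∞≡fin : ∀ {x k} → suc∞ x ≡ fin k → ∃[ m ] (k ≡ suc m × x ≡ fin m)
suc∞≡fin {fin m} refl = m , refl , refl

min∞-≡ˡ : ∀ {a b} → a ≤∞ b → min∞ a b ≡ a
min∞-≡ˡ (fin≤fin a≤b)     = cong fin (m≤n⇒m⊓n≡m a≤b)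
min∞-≡ˡ {fin a} ≤∞-top = refl
min∞-≡ˡ {∞}     ≤∞-top = refl

min∞-≡ʳ : ∀ {a b} → b ≤∞ a → min∞ a b ≡ b
min∞-≡ʳ (fin≤fin b≤a) = cong fin (m≥n⇒m⊓n≡n b≤a)
min∞-≡ʳ ≤∞-top        = refl

max∞-≡ˡ : ∀ {a b} → b ≤∞ a → max∞ a b ≡ a
max∞-≡ˡ (fin≤fin b≤a) = cong fin (m≥n⇒m⊔n≡m b≤a)
max∞-≡ˡ ≤∞-top        = refl

max∞-≡ʳ : ∀ {a b} → a ≤∞ b → max∞ a b ≡ b
max∞-≡ʳ (fin≤fin a≤b)     = cong fin (m≤n⇒m⊔n≡n a≤b)
max∞-≡ʳ {fin a} ≤∞-top = refl
max∞-≡ʳ {∞}     ≤∞-top = refl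

min∞-≤ˡ : ∀ a b → min∞ a b ≤∞ a
min∞-≤ˡ a b with ≤∞-total a b
... | inj₁ a≤b = ≤∞-reflexive (min∞-≡ˡ a≤b)
... | inj₂ b≤a = ≤∞-trans (≤∞-reflexive (min∞-≡ʳ b≤a)) b≤a

min∞-≤ʳ : ∀ a b → min∞ a b ≤∞ b
min∞-≤ʳ a b with ≤∞-total a b
... | inj₁ a≤b = ≤∞-trans (≤∞-reflexive (min∞-≡ˡ a≤b)) a≤b
... | inj₂ b≤a = ≤∞-reflexive (min∞-≡ʳ b≤a)

max∞-≥ˡ : ∀ a b → a ≤∞ max∞ a b
max∞-≥ˡ a b with ≤∞-total a b
... | inj₁ a≤b = ≤∞-trans a≤b (≤∞-reflexive (sym (max∞-≡ʳ a≤b)))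
... | inj₂ b≤a = ≤∞-reflexive (sym (max∞-≡ˡ b≤a))

max∞-≥ʳ : ∀ a b → b ≤∞ max∞ a b
max∞-≥ʳ a b with ≤∞-total a b
... | inj₁ a≤b = ≤∞-reflexive (sym (max∞-≡ʳ a≤b))
... | inj₂ b≤a = ≤∞-trans b≤a (≤∞-reflexive (sym (max∞-≡ˡ b≤a)))

min∞-sel : ∀ a b → min∞ a b ≡ a ⊎ min∞ a b ≡ b
min∞-sel a b with ≤∞-total a b
... | inj₁ a≤b = inj₁ (min∞-≡ˡ a≤b)
... | inj₂ b≤a = inj₂ (min∞-≡ʳ b≤a)

max∞-sel : ∀ a b → max∞ a b ≡ a ⊎ max∞ a b ≡ b
max∞-sel a b with ≤∞-total a b
... | inj₁ a≤b = inj₂ (max∞-≡ʳ a≤b)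
... | inj₂ b≤a = inj₁ (max∞-≡ˡ b≤a)

Monotone : (ℕ∞ → ℕ∞) → Set
Monotone g = ∀ {a b} → a ≤∞ b → g a ≤∞ g b

min∞-mono-commute : ∀ g → Monotone g → ∀ a b → g (min∞ a b) ≡ min∞ (g a) (g b)
min∞-mono-commute g mono a b with ≤∞-total a b
... | inj₁ a≤b = trans (cong g (min∞-≡ˡ a≤b)) (sym (min∞-≡ˡ (mono a≤b)))
... | inj₂ b≤a = trans (cong g (min∞-≡ʳ b≤a)) (sym (min∞-≡ʳ (mono b≤a)))

max∞-mono-commute : ∀ g → Monotone g → ∀ a b → g (max∞ a b) ≡ max∞ (g a) (g b)
max∞-mono-commute g mono a b with ≤∞-total a b
... | inj₁ a≤b = trans (cong g (max∞-≡ʳ a≤b)) (sym (max∞-≡ʳ (mono a≤b)))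
... | inj₂ b≤a = trans (cong g (max∞-≡ˡ b≤a)) (sym (max∞-≡ˡ (mono b≤a)))

==∞-sound : ∀ a b → (a ==∞ b) ≡ true → a ≡ b
==∞-sound (fin a) (fin b) eq with a ≟ b
... | yes a≡b = cong fin a≡b
==∞-sound ∞       ∞       eq = refl

==∞-refl : ∀ a → (a ==∞ a) ≡ true
==∞-refl (fin a) with a ≟ a
... | yes _  = refl
... | no a≢a = contradiction refl a≢a
==∞-refl ∞ = refl

-- Truncation: trunc i x is the label x as it appears at stage i.

trunc : ℕ → ℕ∞ → ℕ∞
trunc i (fin k) with k ≤? i
... | yes _ = fin k
... | no _  = ∞
trunc i ∞ = ∞

trunc-≤ : ∀ {i k} → k ≤ i → trunc i (fin k) ≡ fin k
trunc-≤ {i} {k} k≤i with k ≤? i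
... | yes _   = refl
... | no k≰i  = contradiction k≤i k≰i

trunc-> : ∀ {i k} → i < k → trunc i (fin k) ≡ ∞
trunc-> {i} {k} i<k with k ≤? i
... | yes k≤i = contradiction k≤i (<⇒≱ i<k)
... | no _    = refl

trunc-fin : ∀ {i x k} → trunc i x ≡ fin k → x ≡ fin k × k ≤ i
trunc-fin {i} {fin m} eq with m ≤? i
trunc-fin {i} {fin m} refl | yes m≤i = refl , m≤i
trunc-fin {x = ∞} ()

trunc-mono : ∀ {i} → Monotone (trunc i)
trunc-mono {i} (fin≤fin {m} {n} m≤n) with n ≤? i
... | yes n≤i = subst (_≤∞ fin n) (sym (trunc-≤ (≤-trans m≤n n≤i))) (fin≤fin m≤n)
... | no _    = ≤∞-top
trunc-mono ≤∞-top = ≤∞-top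

trunc-suc∞ : ∀ i x → suc∞ (trunc i x) ≡ trunc (suc i) (suc∞ x)
trunc-suc∞ i ∞ = refl
trunc-suc∞ i (fin k) with k ≤? i
... | yes k≤i = sym (trunc-≤ (s≤s k≤i))
... | no k≰i  = sym (trunc-> (s≤s (≰⇒> k≰i)))

trunc-weaken : ∀ {x i j} → x ≡ trunc i x → i ≤ j → x ≡ trunc j x
trunc-weaken {∞}     _  _   = refl
trunc-weaken {fin k} eq i≤j = sym (trunc-≤ (≤-trans (proj₂ (trunc-fin (sym eq))) i≤j))

Growth : ℕ → ℕ∞ → ℕ∞ → Set
Growth J x y = y ≡ x ⊎ (x ≡ ∞ × y ≡ fin (suc J))

growth-invisible : ∀ {J j x y} → j ≤ J → Growth J x y → trunc j x ≡ trunc j y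
growth-invisible j≤J (inj₁ refl)         = refl
growth-invisible j≤J (inj₂ (refl , refl)) = sym (trunc-> (s≤s j≤J))

growth-bounded : ∀ {J x y} → x ≡ trunc J x → Growth J x y → y ≡ trunc (suc J) y
growth-bounded x-bounded (inj₁ refl)    = trunc-weaken x-bounded (n≤1+n _)
growth-bounded x-bounded (inj₂ (_ , refl)) = sym (trunc-≤ ≤-refl)

trunc-determined : ∀ x z → trunc 0 x ≡ ∞
                 → (∀ i → trunc i x ≡ ∞ → trunc (suc i) x ≡ trunc (suc i) (suc∞ z))
                 → x ≡ suc∞ z
trunc-determined (fin zero)    z x-pos agree = contradiction (trans (sym (trunc-≤ {0} z≤n)) x-pos) fin≢∞
trunc-determined (fin (suc k)) z x-pos agree =
  sym (proj₁ (trunc-fin (trans (sym (agree k (trunc-> ≤-refl))) (trunc-≤ ≤-refl))))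
trunc-determined ∞ ∞       x-pos agree = refl
trunc-determined ∞ (fin k) x-pos agree =
  contradiction (trans (sym (trunc-≤ ≤-refl)) (sym (agree k refl))) fin≢∞

-- Optimising over the neighbourhood N(s)

module Neighbours (G : GCR) where
  open GCR G

  allStates-complete : ∀ s → s ∈ allStates G
  allStates-complete (x , y , p) =
    ∈-concatMap⁺ _ (lose (∈-allFin x) (∈-concatMap⁺ _ (lose (∈-allFin y) (∈-map⁺ (λ q → x , y , q) (player p)))))
    where
      player : ∀ p → p ∈ allPlayers
      player P1 = here refl
      player P2 = there (here refl)

  -- The fold behind minOver and maxOver: combine with _⊕_ the values f s' of
  -- the neighbours s' of s that occur in xs, starting from e.
  combine : (ℕ∞ → ℕ∞ → ℕ∞) → ℕ∞ → (State → ℕ∞) → State → List State → ℕ∞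
  combine _⊕_ e f s = foldr (λ s' acc → if N s s' then f s' ⊕ acc else acc) e

  combine-cong : ∀ _⊕_ e {f g} → (∀ x → f x ≡ g x) → ∀ s xs → combine _⊕_ e f s xs ≡ combine _⊕_ e g s xs
  combine-cong _⊕_ e f≗g s []       = refl
  combine-cong _⊕_ e f≗g s (x ∷ xs) with N s x
  ... | true  = cong₂ _⊕_ (f≗g x) (combine-cong _⊕_ e f≗g s xs)
  ... | false = combine-cong _⊕_ e f≗g s xs

  combine-commute : ∀ _⊕_ e (h : ℕ∞ → ℕ∞) → (∀ a b → h (a ⊕ b) ≡ h a ⊕ h b) → h e ≡ e
                  → ∀ f s xs → h (combine _⊕_ e f s xs) ≡ combine _⊕_ e (h ∘ f) s xs
  combine-commute _⊕_ e h hom he f s []       = he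
  combine-commute _⊕_ e h hom he f s (x ∷ xs) with N s x
  ... | true  = trans (hom (f x) _) (cong (h (f x) ⊕_) (combine-commute _⊕_ e h hom he f s xs))
  ... | false = combine-commute _⊕_ e h hom he f s xs

  combine-bound : ∀ _⊕_ e (R : ℕ∞ → ℕ∞ → Set) → (∀ {a b c} → R a b → R b c → R a c)
                → (∀ a b → R (a ⊕ b) a) → (∀ a b → R (a ⊕ b) b)
                → ∀ f s {x} xs → x ∈ xs → N s x ≡ true → R (combine _⊕_ e f s xs) (f x)
  combine-bound _⊕_ e R R-trans left right f s (y ∷ xs) (here refl) Nsy rewrite Nsy = left (f y) _
  combine-bound _⊕_ e R R-trans left right f s (y ∷ xs) (there x∈xs) Nsx with N s y
  ... | true  = R-trans (right (f y) _) (combine-bound _⊕_ e R R-trans left right f s xs x∈xs Nsx)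
  ... | false = combine-bound _⊕_ e R R-trans left right f s xs x∈xs Nsx

  combine-attained : ∀ _⊕_ e → (∀ a b → a ⊕ b ≡ a ⊎ a ⊕ b ≡ b) → ∀ f s xs
                   → combine _⊕_ e f s xs ≡ e ⊎ ∃[ x ] (N s x ≡ true × f x ≡ combine _⊕_ e f s xs)
  combine-attained _⊕_ e sel f s []       = inj₁ refl
  combine-attained _⊕_ e sel f s (y ∷ xs) with N s y in Nsy
  ... | false = combine-attained _⊕_ e sel f s xs
  ... | true with sel (f y) (combine _⊕_ e f s xs)
  ...   | inj₁ picks-y    = inj₂ (y , Nsy , sym picks-y)
  ...   | inj₂ picks-rest with combine-attained _⊕_ e sel f s xs
  ...     | inj₁ rest≡e              = inj₁ (trans picks-rest rest≡e)
  ...     | inj₂ (x , Nsx , fx≡rest) = inj₂ (x , Nsx , trans fx≡rest (sym picks-rest))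

  minOver-≤ : ∀ f s {s'} → N s s' ≡ true → minOver G f s ≤∞ f s'
  minOver-≤ f s {s'} =
    combine-bound min∞ ∞ _≤∞_ ≤∞-trans min∞-≤ˡ min∞-≤ʳ f s (allStates G) (allStates-complete s')

  maxOver-≥ : ∀ f s {s'} → N s s' ≡ true → f s' ≤∞ maxOver G f s
  maxOver-≥ f s {s'} =
    combine-bound max∞ (fin 0) (λ a b → b ≤∞ a) (λ p q → ≤∞-trans q p) max∞-≥ˡ max∞-≥ʳ
                  f s (allStates G) (allStates-complete s')

  opt : Player → (State → ℕ∞) → State → ℕ∞
  opt P1 = minOver G
  opt P2 = maxOver G

  opt-cong : ∀ p {f g} → (∀ s → f s ≡ g s) → ∀ s → opt p f s ≡ opt p g s
  opt-cong P1 f≗g s = combine-cong min∞ ∞ f≗g s (allStates G)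
  opt-cong P2 f≗g s = combine-cong max∞ (fin 0) f≗g s (allStates G)

  opt-trunc : ∀ p i f s → trunc i (opt p f s) ≡ opt p (trunc i ∘ f) s
  opt-trunc P1 i f s =
    combine-commute min∞ ∞ (trunc i) (min∞-mono-commute (trunc i) trunc-mono) refl f s (allStates G)
  opt-trunc P2 i f s =
    combine-commute max∞ (fin 0) (trunc i) (max∞-mono-commute (trunc i) trunc-mono) (trunc-≤ {i} z≤n) f s (allStates G)

  -- At an uncaptured state the optimum is the value of some neighbour
  -- (N(s) ≠ ∅, so even the empty-fold values ∞ and 0 are attained).
  opt-attained : ∀ p f s → capture s ≡ false → ∃[ s' ] (N s s' ≡ true × f s' ≡ opt p f s)
  opt-attained P1 f s uncaught with combine-attained min∞ ∞ min∞-sel f s (allStates G)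
  ... | inj₂ found = found
  ... | inj₁ min≡∞ with N-nonempty s uncaught
  ...   | s' , Nss' = s' , Nss' , ≤∞-antisym (subst (f s' ≤∞_) (sym min≡∞) ≤∞-top) (minOver-≤ f s Nss')
  opt-attained P2 f s uncaught with combine-attained max∞ (fin 0) max∞-sel f s (allStates G)
  ... | inj₂ found = found
  ... | inj₁ max≡0 with N-nonempty s uncaught
  ...   | s' , Nss' = s' , Nss' , ≤∞-antisym (maxOver-≥ f s Nss') (subst (_≤∞ f s') (sym max≡0) (0≤∞ (f s')))

  record IsBellman (W : State → ℕ∞) : Set where
    field
      captured   : ∀ s → capture s ≡ true → W s ≡ fin 0
      uncaptured : ∀ s → capture s ≡ false → W s ≡ suc∞ (opt (owner G s) W s)

-- The vertex labelling algorithm and its limit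

module Labelling (G : GCR) where
  open GCR G
  open Neighbours G

  VL-start-captured : ∀ {s} → capture s ≡ true → VL G 0 s ≡ fin 0
  VL-start-captured caught rewrite caught = refl

  VL-start-uncaptured : ∀ {s} → capture s ≡ false → VL G 0 s ≡ ∞
  VL-start-uncaptured uncaught rewrite uncaught = refl

  VL-keep : ∀ i s {k} → VL G i s ≡ fin k → VL G (suc i) s ≡ fin k
  VL-keep i s eq with VL G i s
  VL-keep i s refl | .(fin _) = refl

  VL-update : ∀ i s → VL G i s ≡ ∞ → VL G (suc i) s ≡ suc∞ (opt (owner G s) (VL G i) s)
  VL-update i (x , y , P1) eq with VL G i (x , y , P1)
  VL-update i (x , y , P1) refl | .∞ = refl
  VL-update i (x , y , P2) eq with VL G i (x , y , P2)
  VL-update i (x , y , P2) refl | .∞ = refl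

  VL-stable : ∀ {i j} s {k} → i ≤ j → VL G i s ≡ fin k → VL G j s ≡ fin k
  VL-stable {j = zero}  s z≤n  eq = eq
  VL-stable {j = suc j} s i≤sj eq with m≤n⇒m<n∨m≡n i≤sj
  ... | inj₁ (s≤s i≤j) = VL-keep j s (VL-stable s i≤j eq)
  ... | inj₂ refl      = eq

  VL-labelled-next : ∀ i s {m} → opt (owner G s) (VL G i) s ≡ fin m → ∃[ k ] VL G (suc i) s ≡ fin k
  VL-labelled-next i s opt≡m = by-cases (VL G i s) refl
    where
      by-cases : ∀ v → VL G i s ≡ v → ∃[ k ] VL G (suc i) s ≡ fin k
      by-cases (fin k) VLis = k , VL-keep i s VLis
      by-cases ∞       VLis = _ , trans (VL-update i s VLis) (cong suc∞ opt≡m)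

  Truncates : ℕ → Set
  Truncates J = ∀ s {j} → j ≤ J → VL G j s ≡ trunc j (VL G J s)

  -- A state first labelled at stage J + 1 gets label J + 1: a smaller label
  -- m < J would already have been assigned at stage m + 1.
  new-label : ∀ {J s k} → Truncates J → VL G J s ≡ ∞ → VL G (suc J) s ≡ fin k → k ≡ suc J
  new-label {J} {s} truncJ unlabelled labelled
    with suc∞≡fin (trans (sym (VL-update J s unlabelled)) labelled)
  ... | m , refl , best≡m = cong suc m≡J
    where
      open ≡-Reasoning
      p : Player
      p = owner G s

      best-at : ∀ {j} → j ≤ J → opt p (VL G j) s ≡ trunc j (fin m)
      best-at {j} j≤J = begin
        opt p (VL G j) s             ≡⟨ opt-cong p (λ s' → truncJ s' j≤J) s ⟩
        opt p (trunc j ∘ VL G J) s   ≡⟨ sym (opt-trunc p j (VL G J) s) ⟩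
        trunc j (opt p (VL G J) s)   ≡⟨ cong (trunc j) best≡m ⟩
        trunc j (fin m)              ∎

      m≤J : m ≤ J
      m≤J = proj₂ (trunc-fin (trans (sym (best-at ≤-refl)) best≡m))

      m≮J : ¬ m < J
      m≮J m<J with VL-labelled-next m s (trans (best-at (<⇒≤ m<J)) (trunc-≤ ≤-refl))
      ... | _ , labelled-early = fin≢∞ (trans (sym (VL-stable s m<J labelled-early)) unlabelled)

      m≡J : m ≡ J
      m≡J with m≤n⇒m<n∨m≡n m≤J
      ... | inj₁ m<J = contradiction m<J m≮J
      ... | inj₂ m≡J = m≡J

  label-growth : ∀ {J} → Truncates J → ∀ s → Growth J (VL G J s) (VL G (suc J) s)
  label-growth {J} truncJ s = by-cases (VL G J s) refl (VL G (suc J) s) refl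
    where
      by-cases : ∀ v → VL G J s ≡ v → ∀ w → VL G (suc J) s ≡ w → Growth J (VL G J s) (VL G (suc J) s)
      by-cases (fin k) VLJs _       _     = inj₁ (trans (VL-keep J s VLJs) (sym VLJs))
      by-cases ∞       VLJs ∞       VLsJs = inj₁ (trans VLsJs (sym VLJs))
      by-cases ∞       VLJs (fin k) VLsJs =
        inj₂ (VLJs , trans VLsJs (cong fin (new-label truncJ VLJs VLsJs)))

  truncates : ∀ J → Truncates J
  truncates zero s z≤n with capture s
  ... | true  = sym (trunc-≤ {0} z≤n)
  ... | false = refl
  truncates (suc J) s j≤sJ with m≤n⇒m<n∨m≡n j≤sJ
  ... | inj₁ (s≤s j≤J) = trans (truncates J s j≤J) (growth-invisible j≤J (label-growth (truncates J) s))
  ... | inj₂ refl      = growth-bounded (truncates J s ≤-refl) (label-growth (truncates J) s)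

  module Limit (Tbar : State → ℕ∞) (converges : ∀ s → ∃[ i ] (∀ j → i ≤ j → VL G j s ≡ Tbar s)) where

    VL≡trunc-limit : ∀ i s → VL G i s ≡ trunc i (Tbar s)
    VL≡trunc-limit i s with converges s
    ... | i₀ , stable =
      trans (truncates (i ⊔ i₀) s (m≤m⊔n i i₀)) (cong (trunc i) (stable (i ⊔ i₀) (m≤n⊔m i i₀)))

    limit-isBellman : IsBellman Tbar
    limit-isBellman = record { captured = captured ; uncaptured = uncaptured }
      where
        captured : ∀ s → capture s ≡ true → Tbar s ≡ fin 0
        captured s caught = proj₁ (trunc-fin (trans (sym (VL≡trunc-limit 0 s)) (VL-start-captured caught)))

        uncaptured : ∀ s → capture s ≡ false → Tbar s ≡ suc∞ (opt (owner G s) Tbar s)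
        uncaptured s uncaught =
          trunc-determined (Tbar s) _ (trans (sym (VL≡trunc-limit 0 s)) (VL-start-uncaptured uncaught)) agree
          where
            open ≡-Reasoning
            p : Player
            p = owner G s

            agree : ∀ i → trunc i (Tbar s) ≡ ∞ → trunc (suc i) (Tbar s) ≡ trunc (suc i) (suc∞ (opt p Tbar s))
            agree i invisible = begin
              trunc (suc i) (Tbar s)            ≡⟨ sym (VL≡trunc-limit (suc i) s) ⟩
              VL G (suc i) s                    ≡⟨ VL-update i s (trans (VL≡trunc-limit i s) invisible) ⟩
              suc∞ (opt p (VL G i) s)           ≡⟨ cong suc∞ (opt-cong p (VL≡trunc-limit i) s) ⟩
              suc∞ (opt p (trunc i ∘ Tbar) s)   ≡⟨ cong suc∞ (sym (opt-trunc p i Tbar s)) ⟩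
              suc∞ (trunc i (opt p Tbar s))     ≡⟨ trunc-suc∞ i (opt p Tbar s) ⟩
              trunc (suc i) (suc∞ (opt p Tbar s)) ∎

-- The argmin / argmax strategies for a labelling W

module Strategies (G : GCR) (ord : List (GCR.State G)) (complete : ∀ s → s ∈ ord)
                  (W : GCR.State G → ℕ∞) where
  open GCR G
  open Neighbours G

  neighbourWith : State → ℕ∞ → State → Bool
  neighbourWith s m s' = if N s s' then W s' ==∞ m else false

  neighbourWith-elim : ∀ s m x → neighbourWith s m x ≡ true → N s x ≡ true × W x ≡ m
  neighbourWith-elim s m x test with N s x
  ... | true = refl , ==∞-sound (W x) m test

  neighbourWith-intro : ∀ {s m y} → N s y ≡ true → W y ≡ m → neighbourWith s m y ≡ true
  neighbourWith-intro {y = y} Nsy refl rewrite Nsy = ==∞-refl (W y)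

  firstWhere-found : ∀ (P : State → Bool) {y} xs → y ∈ xs → P y ≡ true
                   → ∃[ x ] (firstWhere G P xs ≡ just x × P x ≡ true)
  firstWhere-found P (z ∷ xs) y∈ Py with P z in Pz
  ... | true = z , refl , Pz
  ... | false with y∈
  ...   | here refl  = contradiction (trans (sym Py) Pz) λ ()
  ...   | there y∈xs = firstWhere-found P xs y∈xs Py

  choose : State → ℕ∞ → State
  choose s m = fromMaybe G s (firstWhere G (neighbourWith s m) ord)

  choose-spec : ∀ s m → ∃[ y ] (N s y ≡ true × W y ≡ m) → N s (choose s m) ≡ true × W (choose s m) ≡ m
  choose-spec s m (y , Nsy , Wy≡m)
    with firstWhere-found (neighbourWith s m) ord (complete y) (neighbourWith-intro Nsy Wy≡m)
  ... | x , found , test =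
    subst (λ r → N s (fromMaybe G s r) ≡ true × W (fromMaybe G s r) ≡ m) (sym found)
          (neighbourWith-elim s m x test)

  argmin-spec : ∀ s → capture s ≡ false → N s (argmin G ord W s) ≡ true × W (argmin G ord W s) ≡ minOver G W s
  argmin-spec s uncaught = choose-spec s _ (opt-attained P1 W s uncaught)

  argmax-spec : ∀ s → capture s ≡ false → N s (argmax G ord W s) ≡ true × W (argmax G ord W s) ≡ maxOver G W s
  argmax-spec s uncaught = choose-spec s _ (opt-attained P2 W s uncaught)

  legal-σ̂¹ : Legal G P1 (σ̂¹ G ord W)
  legal-σ̂¹ h s _ uncaught = proj₁ (argmin-spec s uncaught)

  legal-σ̂² : Legal G P2 (σ̂² G ord W)
  legal-σ̂² h s _ uncaught = proj₁ (argmax-spec s uncaught)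

-- Capture-time bounds for a solution W of the Bellman equations

module Game (G : GCR) (ord : List (GCR.State G)) (complete : ∀ s → s ∈ ord)
            (W : GCR.State G → ℕ∞) (bellman : Neighbours.IsBellman G W) where
  open GCR G
  open Neighbours G
  open Strategies G ord complete W public
  open IsBellman bellman

  run : Strategy G → Strategy G → Pos G → ℕ → Pos G
  run σ¹ σ² p zero    = p
  run σ¹ σ² p (suc t) = run σ¹ σ² (step G σ¹ σ² p) t

  step-run : ∀ σ¹ σ² p t → step G σ¹ σ² (run σ¹ σ² p t) ≡ run σ¹ σ² (step G σ¹ σ² p) t
  step-run σ¹ σ² p zero    = refl
  step-run σ¹ σ² p (suc t) = step-run σ¹ σ² (step G σ¹ σ² p) t

  play≡run : ∀ σ¹ σ² s t → play G σ¹ σ² s t ≡ run σ¹ σ² (alive [] s) t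
  play≡run σ¹ σ² s zero    = refl
  play≡run σ¹ σ² s (suc t) = trans (cong (step G σ¹ σ²) (play≡run σ¹ σ² s t)) (step-run σ¹ σ² (alive [] s) t)

  step-uncaptured : ∀ {σ¹ σ² h s} → capture s ≡ false
                  → step G σ¹ σ² (alive h s) ≡ alive (h ++ [ s ]) (mover G σ¹ σ² (owner G s) h s)
  step-uncaptured uncaught rewrite uncaught = refl

  pursuer-move : ∀ {σ²} → Legal G P2 σ² → ∀ h s → capture s ≡ false
               → W (mover G (σ̂¹ G ord W) σ² (owner G s) h s) ≤∞ opt (owner G s) W s
  pursuer-move legal h (x , y , P1) uncaught = ≤∞-reflexive (proj₂ (argmin-spec _ uncaught))
  pursuer-move legal h (x , y , P2) uncaught = maxOver-≥ W _ (legal h _ refl uncaught)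

  evader-move : ∀ {σ¹} → Legal G P1 σ¹ → ∀ h s → capture s ≡ false
              → opt (owner G s) W s ≤∞ W (mover G σ¹ (σ̂² G ord W) (owner G s) h s)
  evader-move legal h (x , y , P1) uncaught = minOver-≤ W _ (legal h _ refl uncaught)
  evader-move legal h (x , y , P2) uncaught = ≤∞-reflexive (sym (proj₂ (argmax-spec _ uncaught)))

  captured-low : ∀ {s t} → capture s ≡ true → ¬ (fin (suc t) ≤∞ W s)
  captured-low {s} caught above with subst (fin (suc _) ≤∞_) (captured s caught) above
  ... | fin≤fin ()

  pursuer-bound : ∀ {σ²} → Legal G P2 σ² → ∀ m h s → W s ≤∞ fin m
                → ∃[ t ] (t ≤ m × CapturedAt G (run (σ̂¹ G ord W) σ² (alive h s) t))
  pursuer-bound legal m h s W≤m with capture s in caught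
  ... | true = 0 , z≤n , caught
  ... | false with suc∞≤fin (subst (_≤∞ fin m) (uncaptured s caught) W≤m)
  ...   | m' , refl , opt≤m'
    with pursuer-bound legal m' (h ++ [ s ]) _ (≤∞-trans (pursuer-move legal h s caught) opt≤m')
  ...     | t , t≤m' , captured-later =
    suc t , s≤s t≤m' ,
    subst (λ p → CapturedAt G (run (σ̂¹ G ord W) _ p t)) (sym (step-uncaptured caught)) captured-later

  evader-bound : ∀ {σ¹} → Legal G P1 σ¹ → ∀ t h s → fin (suc t) ≤∞ W s
               → ¬ CapturedAt G (run σ¹ (σ̂² G ord W) (alive h s) t)
  evader-bound legal zero    h s above caught = captured-low caught above
  evader-bound legal (suc t) h s above with capture s in caught
  ... | true  = λ _ → captured-low caught above
  ... | false =
    evader-bound legal t (h ++ [ s ]) _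
      (≤∞-trans (fin≤suc∞ (subst (fin (suc (suc t)) ≤∞_) (uncaptured s caught) above))
                (evader-move legal h s caught))

  CapTime≤-intro : ∀ p x → (∀ m → x ≤∞ fin m → ∃[ t ] (t ≤ m × CapturedAt G (p t))) → CapTime≤ G p x
  CapTime≤-intro p (fin k) bound = bound k ≤∞-refl
  CapTime≤-intro p ∞       bound = tt

  ≤CapTime-intro : ∀ p x → (∀ t → fin (suc t) ≤∞ x → ¬ CapturedAt G (p t)) → ≤CapTime G p x
  ≤CapTime-intro p (fin k) survive t t<k = survive t (fin≤fin t<k)
  ≤CapTime-intro p ∞       survive t     = survive t ≤∞-top

  pursuer-guarantee : ∀ s σ² → Legal G P2 σ² → CapTime≤ G (play G (σ̂¹ G ord W) σ² s) (W s)
  pursuer-guarantee s σ² legal = CapTime≤-intro _ (W s) λ m W≤m →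
    let t , t≤m , caught = pursuer-bound legal m [] s W≤m
    in t , t≤m , subst (CapturedAt G) (sym (play≡run _ σ² s t)) caught

  evader-guarantee : ∀ s σ¹ → Legal G P1 σ¹ → ≤CapTime G (play G σ¹ (σ̂² G ord W) s) (W s)
  evader-guarantee s σ¹ legal = ≤CapTime-intro _ (W s) λ t above caught →
    evader-bound legal t [] s above (subst (CapturedAt G) (play≡run σ¹ _ s t) caught)

proposition3p6 : (G : GCR) → (ord : List (GCR.State G)) → Unique ord → (∀ s → s ∈ ord)
    → (Tbar : GCR.State G → ℕ∞)
    → (∀ s → ∃[ i ] (∀ j → i ≤ j → VL G j s ≡ Tbar s))
    → Legal G P1 (σ̂¹ G ord Tbar) × Legal G P2 (σ̂² G ord Tbar)
      × (∀ (s : GCR.State G) (σ¹ σ² : Strategy G) → Legal G P1 σ¹ → Legal G P2 σ²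
          → CapTime≤ G (play G (σ̂¹ G ord Tbar) σ² s) (Tbar s)
            × ≤CapTime G (play G σ¹ (σ̂² G ord Tbar) s) (Tbar s))
proposition3p6 G ord _ complete Tbar converges =
  legal-σ̂¹ , legal-σ̂² ,
  λ s σ¹ σ² legal¹ legal² → pursuer-guarantee s σ² legal² , evader-guarantee s σ¹ legal¹
  where
    open Labelling.Limit G Tbar converges using (limit-isBellman)
    open Game G ord complete Tbar limit-isBellman
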